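{- Let $w$ be a pp-irreducible string and let $c$ be the center of a nonempty suffix palindrome of $w$ (so $c<|w|$ and $c+\rho_w(c)=|w|$). Then $w$ is ss-reducible if and only if $\rho_w(c-\rho_w(c))\ge \rho_w(c)$, with the convention $\rho_w(0)=0$.
   Context: Strings over an alphabet $\Sigma$, positions $1,\dots,|w|$, $w[i:j]=w[i]\cdots w[j]$ (empty if $j<i$), $\overline{x}$ the reverse of $x$. A palindrome means an even palindrome $x\overline{x}$. An occurrence $w[i:j]$ of a palindrome has center $c=(i+j-1)/2$, i.e., it is $w[c-r+1:c+r]$ with radius $r$. For a position $c$ of $w$, $\rho_w(c)$ is the largest $r\ge 0$ with $c-r\ge 0$, $c+r\le |w|$ and $w[c-r+1:c+r]$ a palindrome. A Z-shape is $x\overline{x}x$ with $x$ nonempty. The relation $\to$ is $uy\overline{y}yv\to uyv$ ($y$ nonempty); reducible means some reduction applies (equivalently, a Z-shape occurs as a substring), irreducible otherwise. $w$ is pp-irreducible if $w[1:|w|-1]$ is irreducible; ss-reducible if reducible and pp-irreducible. -}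

module Defs where

open import Data.Nat using (ℕ; _+_; _∸_; _*_; _≤_)
open import Data.List using (List; []; _∷_; _++_; reverse; take; drop; length)
open import Data.Product using (Σ; ∃; _×_)
open import Relation.Binary.PropositionalEquality using (_≡_)
open import Relation.Nullary using (¬_)

module _ {A : Set} where

  -- w[i:j] with 1-based positions (empty if j < i)
  sub : List A → ℕ → ℕ → List A
  sub w i j = take (j + 1 ∸ i) (drop (i ∸ 1) w)

  NonEmpty : List A → Set
  NonEmpty x = ¬ (x ≡ [])

  Palindrome : List A → Set
  Palindrome s = ∃ λ (x : List A) → s ≡ x ++ reverse x

  Reducible : List A → Set
  Reducible w = ∃ λ (u : List A) → ∃ λ (y : List A) → ∃ λ (v : List A) →
    NonEmpty y × (w ≡ u ++ y ++ reverse y ++ y ++ v)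

  Irreducible : List A → Set
  Irreducible w = ¬ Reducible w

  PPIrreducible : List A → Set
  PPIrreducible w = Irreducible (sub w 1 (length w ∸ 1))

  SSReducible : List A → Set
  SSReducible w = Reducible w × PPIrreducible w

  PalAt : List A → ℕ → ℕ → Set
  PalAt w c r = (r ≤ c) × (c + r ≤ length w) × Palindrome (sub w (c ∸ r + 1) (c + r))

  IsRho : List A → ℕ → ℕ → Set
  IsRho w c r = PalAt w c r × (∀ r' → PalAt w c r' → r' ≤ r)

-- Positions are 0-based, and a factor s occurs at ℓ in w when w = α s β with |α| = ℓ.  The
-- suffix palindrome is x x̄ occurring at d = c − r, and a Z-shape y ȳ y is the palindrome
-- y ȳ followed, |y| later, by the palindrome ȳ y.
--   (⇐) If ρ(d) ≥ r, the palindrome of radius r centred at d ends exactly where x x̄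
--       starts; the two adjacent palindromes form a Z-shape, so w is reducible.
--   (⇒) As w[1 : |w|−1] is irreducible, every Z-shape y ȳ y of w is a suffix.  Comparing it
--       with x x̄ through mirror images (inside a palindrome P = reverse P, every factor s
--       has the mirror image reverse s) produces, whenever |y| ≠ r, a nonempty Z-shape
--       ending earlier, which is impossible.  So |y| = r, and y ȳ is a palindrome of radius
--       r centred at d, whence ρ(d) ≥ r.
module Submission where

open import Defs
open import Data.Nat using (ℕ; suc; _+_; _∸_; _≤_; _<_; z≤n; s≤s; _≤?_; _<?_)
open import Data.Nat.Properties
open import Data.Nat.Tactic.RingSolver using (solve; solve-∀)
open import Data.List using (List; []; _∷_; _++_; reverse; take; drop; length)
open import Data.List.Properties
  using (∷-injective; ++-assoc; ++-identityʳ; length-++; length-reverse; length-take; length-drop;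
         reverse-++; reverse-involutive; take++drop≡id)
open import Data.Product using (∃; ∃₂; _×_; _,_; proj₁; proj₂)
open import Data.Sum using (_⊎_; inj₁; inj₂)
open import Data.Empty using (⊥-elim)
open import Relation.Nullary using (¬_; yes; no)
open import Relation.Binary.PropositionalEquality
open import Relation.Binary.Definitions using (tri<; tri≈; tri>)
open import Function.Bundles using (_⇔_; mk⇔)

≤-offset : ∀ {m n} k → m + k ≡ n → m ≤ n
≤-offset {m} k refl = m≤m+n m k

<-offset : ∀ {m n} → m < n → ∃ λ t → m + suc t ≡ n
<-offset {m} m<n with m≤n⇒∃[o]m+o≡n m<n
... | t , refl = t , +-suc m t

module _ {A : Set} where

  ++-split : ∀ (α α' X Y : List A) → α ++ X ≡ α' ++ Y → length α ≤ length α' →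
             ∃ λ μ → α' ≡ α ++ μ × X ≡ μ ++ Y
  ++-split []      α'       X Y eq _        = α' , refl , eq
  ++-split (a ∷ α) []       X Y eq ()
  ++-split (a ∷ α) (b ∷ α') X Y eq (s≤s le) with ∷-injective eq
  ... | refl , eq′ with ++-split α α' X Y eq′ le
  ...   | μ , refl , X≡μY = μ , refl , X≡μY

  ++-split-≡ : ∀ (α α' X Y : List A) → α ++ X ≡ α' ++ Y → length α ≡ length α' →
               α ≡ α' × X ≡ Y
  ++-split-≡ []      []       X Y eq _   = refl , eq
  ++-split-≡ []      (_ ∷ _)  X Y eq ()
  ++-split-≡ (_ ∷ _) []       X Y eq ()
  ++-split-≡ (a ∷ α) (b ∷ α') X Y eq len with ∷-injective eq
  ... | refl , eq′ with ++-split-≡ α α' X Y eq′ (suc-injective len)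
  ...   | refl , X≡Y = refl , X≡Y

  take-over-prefix : ∀ (α X : List A) k → take (length α + k) (α ++ X) ≡ α ++ take k X
  take-over-prefix []      X k = refl
  take-over-prefix (a ∷ α) X k = cong (a ∷_) (take-over-prefix α X k)

  drop-over-prefix : ∀ (α X : List A) → drop (length α) (α ++ X) ≡ X
  drop-over-prefix []      X = refl
  drop-over-prefix (a ∷ α) X = drop-over-prefix α X

  take-length-prefix : ∀ (s β : List A) → take (length s) (s ++ β) ≡ s
  take-length-prefix s β =
    trans (cong (λ n → take n (s ++ β)) (sym (+-identityʳ (length s))))
          (trans (take-over-prefix s β 0) (++-identityʳ s))


  ++-regroup : ∀ (α s t β : List A) → α ++ (s ++ t) ++ β ≡ (α ++ s) ++ t ++ β
  ++-regroup α s t β = trans (cong (α ++_) (++-assoc s t β)) (sym (++-assoc α s (t ++ β)))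

  Occurs : List A → ℕ → List A → Set
  Occurs w ℓ s = ∃₂ λ (α β : List A) → length α ≡ ℓ × w ≡ α ++ s ++ β

  occurs-fits : ∀ {w ℓ s} → Occurs w ℓ s → ℓ + length s ≤ length w
  occurs-fits {s = s} (α , β , refl , refl) = ≤-offset (length β) (begin
    length α + length s + length β     ≡⟨ +-assoc (length α) (length s) (length β) ⟩
    length α + (length s + length β)   ≡⟨ cong (length α +_) (sym (length-++ s)) ⟩
    length α + length (s ++ β)         ≡⟨ sym (length-++ α) ⟩
    length (α ++ s ++ β)               ∎)
    where open ≡-Reasoning

  occurs-prefix : ∀ {w ℓ} s t → Occurs w ℓ (s ++ t) → Occurs w ℓ s
  occurs-prefix s t (α , β , len , eq) = α , t ++ β , len , trans eq (cong (α ++_) (++-assoc s t β))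

  occurs-suffix : ∀ {w ℓ} s t → Occurs w ℓ (s ++ t) → Occurs w (ℓ + length s) t
  occurs-suffix s t (α , β , refl , eq) = α ++ s , β , length-++ α , trans eq (++-regroup α s t β)

  occurs-infix : ∀ {w ℓ} γ s δ → Occurs w ℓ (γ ++ s ++ δ) → Occurs w (ℓ + length γ) s
  occurs-infix γ s δ occ = occurs-prefix s δ (occurs-suffix γ (s ++ δ) occ)

  occurs-unique : ∀ {w ℓ s t} → Occurs w ℓ s → Occurs w ℓ t → length s ≡ length t → s ≡ t
  occurs-unique {s = s} {t} (α , β , refl , refl) (α' , β' , len' , eq) len =
    proj₁ (++-split-≡ s t β β' (proj₂ (++-split-≡ α α' (s ++ β) (t ++ β') eq (sym len'))) len)

  occurs-within : ∀ {w ℓ ℓ' P s} → Occurs w ℓ P → Occurs w ℓ' s →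
    ℓ ≤ ℓ' → ℓ' + length s ≤ ℓ + length P → ∃₂ λ γ δ → P ≡ γ ++ s ++ δ × ℓ + length γ ≡ ℓ'
  occurs-within {P = P} {s} (α , β , refl , refl) (α' , β' , refl , eq) ℓ≤ℓ' fits
    with ++-split α α' (P ++ β) (s ++ β') eq ℓ≤ℓ'
  ... | μ , refl , rest with ++-split (μ ++ s) P β' β (trans (++-assoc μ s β') (sym rest)) μs≤P
    where
    μs≤P : length (μ ++ s) ≤ length P
    μs≤P = +-cancelˡ-≤ (length α) _ _ (subst (_≤ length α + length P) (begin
      length (α ++ μ) + length s         ≡⟨ cong (_+ length s) (length-++ α) ⟩
      length α + length μ + length s     ≡⟨ +-assoc (length α) (length μ) (length s) ⟩
      length α + (length μ + length s)   ≡⟨ cong (length α +_) (sym (length-++ μ)) ⟩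
      length α + length (μ ++ s)         ∎) fits)
      where open ≡-Reasoning
  ... | ν , refl , _ = μ , ν , ++-assoc μ s ν , sym (length-++ α)

  occurs-glue : ∀ {w ℓ} s t u → Occurs w ℓ (s ++ t) → Occurs w (ℓ + length s) (t ++ u) →
    Occurs w ℓ (s ++ t ++ u)
  occurs-glue s t u (α , β , refl , refl) (α' , β' , len' , eq)
    with ++-split-≡ (α ++ s) α' (t ++ β) ((t ++ u) ++ β')
           (trans (sym (++-regroup α s t β)) eq) (trans (length-++ α) (sym len'))
  ... | refl , _ = α , β' , refl , trans eq (sym (++-regroup α s (t ++ u) β'))

  occurs-take : ∀ {w ℓ s} m → Occurs w ℓ s → ℓ + length s ≤ m → Occurs (take m w) ℓ s
  occurs-take {s = s} m (α , β , refl , refl) fits with m≤n⇒∃[o]m+o≡n fits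
  ... | k , refl = α , take k β , refl , (begin
    take (length α + length s + k) (α ++ s ++ β)
      ≡⟨ cong (λ n → take n (α ++ s ++ β)) (+-assoc (length α) (length s) k) ⟩
    take (length α + (length s + k)) (α ++ s ++ β) ≡⟨ take-over-prefix α (s ++ β) (length s + k) ⟩
    α ++ take (length s + k) (s ++ β)              ≡⟨ cong (α ++_) (take-over-prefix s β k) ⟩
    α ++ s ++ take k β                             ∎)
    where open ≡-Reasoning

  window-occurs : ∀ w ℓ m → ℓ ≤ length w → Occurs w ℓ (take m (drop ℓ w))
  window-occurs w ℓ m ℓ≤ = take ℓ w , drop m (drop ℓ w) ,
    trans (length-take ℓ w) (m≤n⇒m⊓n≡m ℓ≤) ,
    sym (trans (cong (take ℓ w ++_) (take++drop≡id m (drop ℓ w))) (take++drop≡id ℓ w))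

  occurs⇒window : ∀ {w ℓ s} → Occurs w ℓ s → take (length s) (drop ℓ w) ≡ s
  occurs⇒window {s = s} (α , β , refl , refl) =
    trans (cong (take (length s)) (drop-over-prefix α (s ++ β))) (take-length-prefix s β)

  window-length : ∀ (w : List A) ℓ m → ℓ + m ≤ length w → length (take m (drop ℓ w)) ≡ m
  window-length w ℓ m fits = trans (length-take m (drop ℓ w)) (m≤n⇒m⊓n≡m
    (subst (m ≤_) (sym (length-drop ℓ w)) (m+n≤o⇒m≤o∸n m (subst (_≤ length w) (+-comm ℓ m) fits))))


  occurs-reflect : ∀ {w ℓ ℓ' P s} ℓ'' → reverse P ≡ P → Occurs w ℓ P → Occurs w ℓ' s →
    ℓ ≤ ℓ' → ℓ' + length s ≤ ℓ + length P → ℓ'' + (ℓ' + length s) ≡ ℓ + (ℓ + length P) →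
    Occurs w ℓ'' (reverse s)
  occurs-reflect {w} {ℓ} {s = s} ℓ'' P-sym occP occs ℓ≤ℓ' fits mirror
    with occurs-within occP occs ℓ≤ℓ' fits
  ... | γ , δ , refl , refl =
    subst (λ n → Occurs w n (reverse s)) position
      (occurs-infix (reverse δ) (reverse s) (reverse γ) (subst (Occurs w ℓ) reversed occP))
    where
    open ≡-Reasoning
    reversed : γ ++ s ++ δ ≡ reverse δ ++ reverse s ++ reverse γ
    reversed = begin
      γ ++ s ++ δ                            ≡⟨ sym P-sym ⟩
      reverse (γ ++ s ++ δ)                  ≡⟨ reverse-++ γ (s ++ δ) ⟩
      reverse (s ++ δ) ++ reverse γ          ≡⟨ cong (_++ reverse γ) (reverse-++ s δ) ⟩
      (reverse δ ++ reverse s) ++ reverse γ  ≡⟨ ++-assoc (reverse δ) (reverse s) (reverse γ) ⟩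
      reverse δ ++ reverse s ++ reverse γ    ∎
    shift : ∀ a b c d → (a + d) + (a + b + c) ≡ a + (a + (b + (c + d)))
    shift = solve-∀
    position : ℓ + length (reverse δ) ≡ ℓ''
    position = +-cancelʳ-≡ (ℓ + length γ + length s) _ _ (begin
      ℓ + length (reverse δ) + (ℓ + length γ + length s)
        ≡⟨ cong (λ n → ℓ + n + (ℓ + length γ + length s)) (length-reverse δ) ⟩
      ℓ + length δ + (ℓ + length γ + length s)
        ≡⟨ shift ℓ (length γ) (length s) (length δ) ⟩
      ℓ + (ℓ + (length γ + (length s + length δ)))
        ≡⟨ cong (λ n → ℓ + (ℓ + (length γ + n))) (sym (length-++ s)) ⟩
      ℓ + (ℓ + (length γ + length (s ++ δ)))
        ≡⟨ cong (λ n → ℓ + (ℓ + n)) (sym (length-++ γ)) ⟩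
      ℓ + (ℓ + length (γ ++ s ++ δ))
        ≡⟨ sym mirror ⟩
      ℓ'' + (ℓ + length γ + length s) ∎)


  -- `PalOcc w ℓ k`: an even palindrome x x̄ with |x| = k occurs at position ℓ of w
  -- (its centre is ℓ + k).
  PalOcc : List A → ℕ → ℕ → Set
  PalOcc w ℓ k = ∃ λ x → length x ≡ k × Occurs w ℓ (x ++ reverse x)

  length-palindrome : ∀ (x : List A) → length (x ++ reverse x) ≡ length x + length x
  length-palindrome x = trans (length-++ x) (cong (length x +_) (length-reverse x))

  reverse-palindrome : ∀ (x : List A) → reverse (x ++ reverse x) ≡ x ++ reverse x
  reverse-palindrome x = trans (reverse-++ x (reverse x)) (cong (_++ reverse x) (reverse-involutive x))

  palindrome-restrict : ∀ {w ℓ k} ℓ' j → PalOcc w ℓ k → j ≤ k → ℓ' + j ≡ ℓ + k → PalOcc w ℓ' j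
  palindrome-restrict {w} {ℓ} ℓ' j (x , refl , occ) j≤k centre with m≤n⇒∃[o]m+o≡n j≤k
  ... | o , j+o≡|x| = inner , inner-length ,
    subst (λ n → Occurs w n (inner ++ reverse inner)) position
      (occurs-infix outer (inner ++ reverse inner) (reverse outer) (subst (Occurs w ℓ) split occ))
    where
    open ≡-Reasoning
    outer = take o x
    inner = drop o x
    inner-length : length inner ≡ j
    inner-length = trans (length-drop o x) (trans (cong (_∸ o) (sym j+o≡|x|)) (m+n∸n≡m j o))
    split : x ++ reverse x ≡ outer ++ (inner ++ reverse inner) ++ reverse outer
    split = begin
      x ++ reverse x
        ≡⟨ cong (λ z → z ++ reverse z) (sym (take++drop≡id o x)) ⟩
      (outer ++ inner) ++ reverse (outer ++ inner)
        ≡⟨ cong ((outer ++ inner) ++_) (reverse-++ outer inner) ⟩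
      (outer ++ inner) ++ reverse inner ++ reverse outer
        ≡⟨ ++-assoc outer inner _ ⟩
      outer ++ inner ++ reverse inner ++ reverse outer
        ≡⟨ cong (outer ++_) (sym (++-assoc inner (reverse inner) _)) ⟩
      outer ++ (inner ++ reverse inner) ++ reverse outer ∎
    o≤|x| : o ≤ length x
    o≤|x| = ≤-offset j (trans (+-comm o j) j+o≡|x|)
    position : ℓ + length outer ≡ ℓ'
    position = +-cancelʳ-≡ j _ _ (begin
      ℓ + length outer + j ≡⟨ cong (λ n → ℓ + n + j) (trans (length-take o x) (m≤n⇒m⊓n≡m o≤|x|)) ⟩
      ℓ + o + j            ≡⟨ trans (+-assoc ℓ o j) (cong (ℓ +_) (+-comm o j)) ⟩
      ℓ + (j + o)          ≡⟨ cong (ℓ +_) j+o≡|x| ⟩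
      ℓ + length x         ≡⟨ sym centre ⟩
      ℓ' + j               ∎)

  palindrome-reflect : ∀ {w ℓ k ℓ' j} ℓ'' → PalOcc w ℓ k → PalOcc w ℓ' j →
    ℓ ≤ ℓ' → ℓ' + (j + j) ≤ ℓ + (k + k) → ℓ'' + (ℓ' + (j + j)) ≡ ℓ + (ℓ + (k + k)) → PalOcc w ℓ'' j
  palindrome-reflect {w} ℓ'' (x , refl , occP) (y , refl , occQ) ℓ≤ℓ' fits mirror
    rewrite sym (length-palindrome x) | sym (length-palindrome y) =
    y , refl , subst (Occurs w ℓ'') (reverse-palindrome y)
      (occurs-reflect ℓ'' (reverse-palindrome x) occP occQ ℓ≤ℓ' fits mirror)


  ZOcc : List A → ℕ → ℕ → Set
  ZOcc w ℓ k = ∃ λ y → length y ≡ k × Occurs w ℓ (y ++ reverse y ++ y)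

  length-zshape : ∀ (y : List A) → length (y ++ reverse y ++ y) ≡ length y + (length y + length y)
  length-zshape y = trans (length-++ y) (cong (length y +_)
    (trans (length-++ (reverse y)) (cong (_+ length y) (length-reverse y))))

  zshape-palindromes : ∀ {w ℓ k} → ZOcc w ℓ k → PalOcc w ℓ k × PalOcc w (ℓ + k) k
  zshape-palindromes {w} {ℓ} (y , refl , occ) =
    (y , refl , occurs-prefix (y ++ reverse y) y (subst (Occurs w ℓ) (sym (++-assoc y (reverse y) y)) occ)) ,
    (reverse y , length-reverse y ,
      subst (λ z → Occurs w (ℓ + length y) (reverse y ++ z)) (sym (reverse-involutive y))
        (occurs-suffix y (reverse y ++ y) occ))

  zshape-from-palindromes : ∀ {w ℓ k} → PalOcc w ℓ k → PalOcc w (ℓ + k) k → ZOcc w ℓ k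
  zshape-from-palindromes {w} {ℓ} (y , refl , occ₁) (z , |z|≡|y| , occ₂) =
    y , refl , occurs-glue y (reverse y) y occ₁ second
    where
    z≡ȳ : z ≡ reverse y
    z≡ȳ = occurs-unique (occurs-prefix z (reverse z) occ₂) (occurs-suffix y (reverse y) occ₁)
            (trans |z|≡|y| (sym (length-reverse y)))
    second : Occurs w (ℓ + length y) (reverse y ++ y)
    second = subst (λ u → Occurs w (ℓ + length y) (reverse y ++ u)) (reverse-involutive y)
               (subst (λ u → Occurs w (ℓ + length y) (u ++ reverse u)) z≡ȳ occ₂)

  zshape-reflect : ∀ {w a e d r} ℓ'' → ZOcc w a e → PalOcc w d r →
    d ≤ a → a + (e + (e + e)) ≤ d + (r + r) → ℓ'' + (a + (e + (e + e))) ≡ d + (d + (r + r)) →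
    ZOcc w ℓ'' e
  zshape-reflect {w} ℓ'' (y , refl , occZ) (x , refl , occP) d≤a fits mirror
    rewrite sym (length-palindrome x) | sym (length-zshape y) =
    reverse y , length-reverse y ,
      subst (Occurs w ℓ'') reversed (occurs-reflect ℓ'' (reverse-palindrome x) occP occZ d≤a fits mirror)
    where
    open ≡-Reasoning
    reversed : reverse (y ++ reverse y ++ y) ≡ reverse y ++ reverse (reverse y) ++ reverse y
    reversed = begin
      reverse (y ++ reverse y ++ y)                      ≡⟨ reverse-++ y (reverse y ++ y) ⟩
      reverse (reverse y ++ y) ++ reverse y              ≡⟨ cong (_++ reverse y) (reverse-++ (reverse y) y) ⟩
      (reverse y ++ reverse (reverse y)) ++ reverse y    ≡⟨ ++-assoc (reverse y) _ (reverse y) ⟩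
      reverse y ++ reverse (reverse y) ++ reverse y      ∎

  zshape-regroup : ∀ (y v : List A) → (y ++ reverse y ++ y) ++ v ≡ y ++ reverse y ++ y ++ v
  zshape-regroup y v = trans (++-assoc y (reverse y ++ y) v) (cong (y ++_) (++-assoc (reverse y) y v))

  reducible⇒zshape : ∀ {w} → Reducible w → ∃₂ λ ℓ k → 1 ≤ k × ZOcc w ℓ k
  reducible⇒zshape (u , [] , v , nonempty , eq) = ⊥-elim (nonempty refl)
  reducible⇒zshape (u , y@(_ ∷ _) , v , nonempty , eq) =
    length u , length y , s≤s z≤n , y , refl , u , v , refl ,
    trans eq (cong (u ++_) (sym (zshape-regroup y v)))

  zshape⇒reducible : ∀ {w ℓ k} → ZOcc w ℓ k → 1 ≤ k → Reducible w
  zshape⇒reducible ([] , refl , _) ()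
  zshape⇒reducible (y@(_ ∷ _) , refl , α , β , _ , eq) _ =
    α , y , β , (λ ()) , trans eq (cong (α ++_) (zshape-regroup y β))

  ZShapeBefore : List A → ℕ → Set
  ZShapeBefore w n = ∃₂ λ ℓ k → 1 ≤ k × ℓ + (k + (k + k)) < n × ZOcc w ℓ k

  sub-prefix : ∀ (w : List A) m → sub w 1 m ≡ take m w
  sub-prefix w m = cong (λ n → take n w) (m+n∸n≡m m 1)

  no-early-zshape : ∀ {w} → PPIrreducible w → ¬ ZShapeBefore w (length w)
  no-early-zshape {w} pp (ℓ , k , 1≤k , early , y , |y| , occ) =
    pp (subst Reducible (sym (sub-prefix w (length w ∸ 1)))
          (zshape⇒reducible (y , |y| , occurs-take (length w ∸ 1) occ fits) 1≤k))
    where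
    fits : ℓ + length (y ++ reverse y ++ y) ≤ length w ∸ 1
    fits = subst (λ n → ℓ + n ≤ length w ∸ 1)
             (sym (trans (length-zshape y) (cong (λ m → m + (m + m)) |y|))) (<⇒≤pred early)

  zshape-at-end : ∀ {w a e} → PPIrreducible w → ZOcc w a e → 1 ≤ e → a + (e + (e + e)) ≡ length w
  zshape-at-end {w} {a} pp Z@(y , refl , occ) 1≤e with a + (length y + (length y + length y)) <? length w
  ... | yes early = ⊥-elim (no-early-zshape pp (a , length y , 1≤e , early , Z))
  ... | no  late  = ≤-antisym (subst (λ n → a + n ≤ length w) (length-zshape y) (occurs-fits occ)) (≮⇒≥ late)

  -- With δ = l − s
  -- and μ = s − δ: the longer one cut down to half-length δ, and the shorter one cut down
  -- likewise and mirrored through the longer one's centre, are adjacent, so they form a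
  -- Z-shape; it ends δ + μ before the common end.
  nested-palindromes : ∀ {w q l p s} → PalOcc w q l → PalOcc w p s →
    p + (s + s) ≡ q + (l + l) → s < l → l ≤ s + s → ZShapeBefore w (q + (l + l))
  nested-palindromes {w} {q} {p = p} {s} long short ends s<l l≤2s with <-offset s<l
  ... | t , refl with m≤n⇒∃[o]m+o≡n (+-cancelˡ-≤ s (suc t) s l≤2s)
  ... | μ , refl with +-cancelʳ-≡ (suc t + μ + (suc t + μ)) p (q + (suc t + suc t))
                        (trans ends (solve (q ∷ t ∷ μ ∷ [])))
  ... | refl = q + μ , suc t , s≤s z≤n , ≤-offset (μ + t) (solve (q ∷ t ∷ μ ∷ [])) ,
               zshape-from-palindromes mirrored cut
    where
    cut : PalOcc w (q + μ + suc t) (suc t)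
    cut = palindrome-restrict (q + μ + suc t) (suc t) long
            (≤-offset (μ + suc t) (solve (t ∷ μ ∷ []))) (solve (q ∷ t ∷ μ ∷ []))
    short-cut : PalOcc w (q + μ + (suc t + suc t)) (suc t)
    short-cut = palindrome-restrict (q + μ + (suc t + suc t)) (suc t) short
                  (≤-offset μ refl) (solve (q ∷ t ∷ μ ∷ []))
    mirrored : PalOcc w (q + μ) (suc t)
    mirrored = palindrome-reflect (q + μ) long short-cut
                 (≤-offset (μ + (suc t + suc t)) (solve (q ∷ t ∷ μ ∷ [])))
                 (≤-offset μ (solve (q ∷ t ∷ μ ∷ []))) (solve (q ∷ t ∷ μ ∷ []))

  -- A Z-shape of half-length e ending where a palindrome of half-length r > 2e ends lies
  -- inside that palindrome; its mirror image is a Z-shape at the palindrome's start.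
  zshape-inside-palindrome : ∀ {w a e d r} → ZOcc w a e → PalOcc w d r →
    a + (e + (e + e)) ≡ d + (r + r) → e + e < r → 1 ≤ e → ZShapeBefore w (d + (r + r))
  zshape-inside-palindrome {a = a} {e} {d} Z P ends 2e<r 1≤e with <-offset 2e<r
  ... | t , refl with +-cancelʳ-≡ (e + (e + e)) a (d + (e + (suc t + suc t)))
                        (trans ends (solve (e ∷ d ∷ t ∷ [])))
  ... | refl = d , e , 1≤e , ≤-offset (e + (t + suc t)) (solve (e ∷ d ∷ t ∷ [])) ,
               zshape-reflect d Z P (m≤m+n d _) (≤-reflexive ends) (cong (d +_) ends)

  -- A palindrome of half-length r ending where a Z-shape y ȳ y with |y| = e > 2r ends lies
  -- in the last y.  Mirrored through the centre of ȳ y and then through that of y ȳ, it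
  -- lands next to the copy of y ȳ cut down to half-length r: together a Z-shape.
  palindrome-inside-zshape : ∀ {w a e d r} → ZOcc w a e → PalOcc w d r →
    a + (e + (e + e)) ≡ d + (r + r) → r + r < e → 1 ≤ r → ZShapeBefore w (d + (r + r))
  palindrome-inside-zshape {w} {a} {d = d} {r} Z P ends 2r<e 1≤r with <-offset 2r<e
  ... | t , refl with +-cancelʳ-≡ (r + r) d (a + (r + r + suc t) + (r + r + suc t + suc t))
                        (trans (sym ends) (solve (a ∷ r ∷ t ∷ [])))
  ... | refl = a + suc t , r , 1≤r , ≤-offset (r + r + r + t + suc t) (solve (a ∷ r ∷ t ∷ [])) ,
               zshape-from-palindromes twice-mirrored cut
    where
    first : PalOcc w a (r + r + suc t)
    first = proj₁ (zshape-palindromes Z)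
    second : PalOcc w (a + (r + r + suc t)) (r + r + suc t)
    second = proj₂ (zshape-palindromes Z)
    mirrored : PalOcc w (a + (r + r + suc t)) r
    mirrored = palindrome-reflect (a + (r + r + suc t)) second P
                 (m≤m+n _ _) (≤-offset 0 (solve (a ∷ r ∷ t ∷ []))) (solve (a ∷ r ∷ t ∷ []))
    twice-mirrored : PalOcc w (a + suc t) r
    twice-mirrored = palindrome-reflect (a + suc t) first mirrored
                       (m≤m+n _ _) (≤-offset (suc t) (solve (a ∷ r ∷ t ∷ []))) (solve (a ∷ r ∷ t ∷ []))
    cut : PalOcc w (a + suc t + r) r
    cut = palindrome-restrict (a + suc t + r) r first
            (≤-offset (r + suc t) (solve (r ∷ t ∷ []))) (solve (a ∷ r ∷ t ∷ []))

  -- e < r: nested palindromes x x̄ ⊇ ȳ y if r ≤ 2e, otherwise the Z-shape lies inside x x̄.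
  shorter-zshape : ∀ {w a e d r} → ZOcc w a e → PalOcc w d r →
    a + (e + (e + e)) ≡ d + (r + r) → e < r → 1 ≤ e → ZShapeBefore w (d + (r + r))
  shorter-zshape {a = a} {e} {r = r} Z P ends e<r 1≤e with r ≤? e + e
  ... | yes r≤2e =
    nested-palindromes P (proj₂ (zshape-palindromes Z)) (trans (+-assoc a e (e + e)) ends) e<r r≤2e
  ... | no  r≰2e = zshape-inside-palindrome Z P ends (≰⇒> r≰2e) 1≤e

  -- r < e: nested palindromes ȳ y ⊇ x x̄ if e ≤ 2r, otherwise x x̄ lies inside the last y.
  longer-zshape : ∀ {w a e d r} → ZOcc w a e → PalOcc w d r →
    a + (e + (e + e)) ≡ d + (r + r) → r < e → 1 ≤ r → ZShapeBefore w (d + (r + r))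
  longer-zshape {w} {a} {e} {r = r} Z P ends r<e 1≤r with e ≤? r + r
  ... | yes e≤2r = subst (ZShapeBefore w) common-end
                     (nested-palindromes (proj₂ (zshape-palindromes Z)) P (sym common-end) r<e e≤2r)
    where
    common-end : a + e + (e + e) ≡ _
    common-end = trans (+-assoc a e (e + e)) ends
  ... | no  e≰2r = palindrome-inside-zshape Z P ends (≰⇒> e≰2r) 1≤r

  suffix-zshape-vs-palindrome : ∀ {w a e d r} → ZOcc w a e → PalOcc w d r →
    a + (e + (e + e)) ≡ d + (r + r) → 1 ≤ e → 1 ≤ r → e ≡ r ⊎ ZShapeBefore w (d + (r + r))
  suffix-zshape-vs-palindrome {e = e} {r = r} Z P ends 1≤e 1≤r with <-cmp e r
  ... | tri< e<r _ _ = inj₂ (shorter-zshape Z P ends e<r 1≤e)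
  ... | tri≈ _ e≡r _ = inj₁ e≡r
  ... | tri> _ _ r<e = inj₂ (longer-zshape Z P ends r<e 1≤r)

  double-injective : ∀ {m n} → m + m ≡ n + n → m ≡ n
  double-injective {m} {n} eq with <-cmp m n
  ... | tri< m<n _ _ = ⊥-elim (<-irrefl eq (+-mono-< m<n m<n))
  ... | tri≈ _ m≡n _ = m≡n
  ... | tri> _ _ n<m = ⊥-elim (<-irrefl (sym eq) (+-mono-< n<m n<m))

  centred-window : ∀ (w : List A) ℓ k → sub w (ℓ + k ∸ k + 1) (ℓ + k + k) ≡ take (k + k) (drop ℓ w)
  centred-window w ℓ k =
    trans (cong (λ i → sub w (i + 1) (ℓ + k + k)) (m+n∸n≡m ℓ k))
          (cong₂ (λ m i → take m (drop i w)) width (m+n∸n≡m ℓ 1))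
    where
    regroup : ℓ + k + k + 1 ≡ ℓ + 1 + (k + k)
    regroup = solve (ℓ ∷ k ∷ [])
    width : ℓ + k + k + 1 ∸ (ℓ + 1) ≡ k + k
    width = trans (cong (_∸ (ℓ + 1)) regroup) (m+n∸m≡n (ℓ + 1) (k + k))

  palAt⇒palOcc : ∀ {w c k} → PalAt w c k → PalOcc w (c ∸ k) k
  palAt⇒palOcc {w} {c} {k} p = centred (subst (λ c → PalAt w c k) (sym (m∸n+n≡m (proj₁ p))) p)
    where
    centred : ∀ {ℓ} → PalAt w (ℓ + k) k → PalOcc w ℓ k
    centred {ℓ} (_ , fits , x , pal) =
      x , double-injective half ,
      subst (Occurs w ℓ) window (window-occurs w ℓ (k + k) (≤-trans (m≤m+n ℓ (k + k)) fits′))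
      where
      fits′ : ℓ + (k + k) ≤ length w
      fits′ = subst (_≤ length w) (+-assoc ℓ k k) fits
      window : take (k + k) (drop ℓ w) ≡ x ++ reverse x
      window = trans (sym (centred-window w ℓ k)) pal
      half : length x + length x ≡ k + k
      half = trans (sym (length-palindrome x)) (trans (cong length (sym window)) (window-length w ℓ (k + k) fits′))

  palOcc⇒palAt : ∀ {w ℓ k} → PalOcc w ℓ k → PalAt w (ℓ + k) k
  palOcc⇒palAt {w} {ℓ} (x , refl , occ) =
    m≤n+m (length x) ℓ ,
    subst (_≤ length w) (trans (cong (ℓ +_) (length-palindrome x)) (sym (+-assoc ℓ _ _))) (occurs-fits occ) ,
    x , trans (centred-window w ℓ (length x))
              (trans (cong (λ m → take m (drop ℓ w)) (sym (length-palindrome x))) (occurs⇒window occ))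

  -- (⇐) If a palindrome of radius r ≥ 1 occurs at d and some palindrome centred at d has
  -- radius r' ≥ r, then cut down to radius r it ends where the first one starts: the two
  -- adjacent palindromes form a Z-shape.
  reducible-if-radius : ∀ {w d r r'} → PalOcc w d r → 1 ≤ r → PalAt w d r' → r ≤ r' → Reducible w
  reducible-if-radius {w} {d} {r} right 1≤r pald r≤r' =
    zshape⇒reducible (zshape-from-palindromes left adjacent) 1≤r
    where
    r≤d : r ≤ d
    r≤d = ≤-trans r≤r' (proj₁ pald)
    left : PalOcc w (d ∸ r) r
    left = palindrome-restrict (d ∸ r) r (palAt⇒palOcc pald) r≤r'
             (trans (m∸n+n≡m r≤d) (sym (m∸n+n≡m (proj₁ pald))))
    adjacent : PalOcc w (d ∸ r + r) r
    adjacent = subst (λ ℓ → PalOcc w ℓ r) (sym (m∸n+n≡m r≤d)) right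

  -- (⇒) Let w be pp-irreducible with a nonempty suffix palindrome x x̄ occurring at d.  A
  -- Z-shape y ȳ y of w is a suffix, so |y| = |x| and y ȳ is a palindrome of radius |x|
  -- centred at d.
  radius-if-reducible : ∀ {w d r} → PPIrreducible w → PalOcc w d r → d + (r + r) ≡ length w → 1 ≤ r →
    Reducible w → PalAt w d r
  radius-if-reducible {w} {d} {r} pp suffix suffix-end 1≤r reducible with reducible⇒zshape reducible
  ... | a , e , 1≤e , Z with zshape-at-end pp Z 1≤e
  ... | Z-end with suffix-zshape-vs-palindrome Z suffix (trans Z-end (sym suffix-end)) 1≤e 1≤r
  ... | inj₂ early = ⊥-elim (no-early-zshape pp (subst (ZShapeBefore w) suffix-end early))
  ... | inj₁ refl = subst (λ c → PalAt w c r) centre (palOcc⇒palAt (proj₁ (zshape-palindromes Z)))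
    where
    centre : a + r ≡ d
    centre = +-cancelʳ-≡ (r + r) (a + r) d (trans (+-assoc a r (r + r)) (trans Z-end (sym suffix-end)))

corollary1 : {A : Set} (w : List A) (c r r' : ℕ) →
    PPIrreducible w → c < length w → IsRho w c r → c + r ≡ length w →
    IsRho w (c ∸ r) r' → (SSReducible w ⇔ r ≤ r')
corollary1 w c r r' pp c<|w| (palc , _) c+r≡|w| (pald , maximal) =
  mk⇔ (λ (reducible , _) → maximal r (radius-if-reducible pp suffix suffix-end 1≤r reducible))
      (λ r≤r' → reducible-if-radius suffix 1≤r pald r≤r' , pp)
  where
  suffix : PalOcc w (c ∸ r) r
  suffix = palAt⇒palOcc palc
  suffix-end : c ∸ r + (r + r) ≡ length w
  suffix-end = trans (sym (+-assoc (c ∸ r) r r)) (trans (cong (_+ r) (m∸n+n≡m (proj₁ palc))) c+r≡|w|)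
  1≤r : 1 ≤ r
  1≤r = +-cancelˡ-≤ c 1 r (subst (_≤ c + r) (+-comm 1 c) (subst (suc c ≤_) (sym c+r≡|w|) c<|w|))
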